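{- For $s\in\mathbb{R}$ and $n\ge1$, \[ S_n(1,s+1;t)=S_n(1,1;t)+s\,S_{n-1}(2,1;t)=\sum_{k=0}^{n}\binom{2n-k}{k}t^k+s\sum_{k=0}^{n-1}\binom{2n-1-k}{k}t^k, \] and for $t\neq-1/4$, \begin{multline*} S_n(1,s+1;t)=\frac{1}{2^{n+1}\sqrt{1+4t}}\Big[\big(1+2s+\sqrt{1+4t}\big)\big(1+2t+\sqrt{1+4t}\big)^n\\ -\big(1+2s-\sqrt{1+4t}\big)\big(1+2t-\sqrt{1+4t}\big)^n\Big], \end{multline*} where $\sqrt{1+4t}$ denotes either (complex) square root of $1+4t$. Moreover, \[ S_n(1,s+1;-1/4)=\frac{4ns+2n+1}{4^n}. \]
   Context: For $a,b\in\mathbb{R}$ the polynomials $S_n(a,b;t)$ in the variable $t$ are defined by $S_0(a,b;t)=1$, $S_1(a,b;t)=at+b$, and $S_n(a,b;t)=(1+2t)S_{n-1}(a,b;t)-t^2S_{n-2}(a,b;t)$ for $n\ge2$. -}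

module Defs where

open import Level using (Level)
open import Data.Nat.Base as ℕ using (ℕ; zero; suc)
open import Data.Nat.Combinatorics using (_C_)
open import Algebra.Bundles using (CommutativeRing; Semiring)

-- Everything is parameterised by a commutative ring R (in the paper R = ℝ or ℂ).
module SPoly {c ℓ : Level} (R : CommutativeRing c ℓ) where
  open CommutativeRing R hiding (zero)
  open import Algebra.Definitions.RawSemiring (Semiring.rawSemiring semiring) using (_×_)
  open import Algebra.Definitions.RawSemiring (Semiring.rawSemiring semiring) public using (_^_)

  -- S n a b t  is the value of the polynomial  S_n(a,b;t)  at t:
  -- S_0 = 1, S_1 = a t + b, S_n = (1 + 2t) S_{n-1} - t^2 S_{n-2}.
  S : ℕ → Carrier → Carrier → Carrier → Carrier
  S zero          a b t = 1#
  S (suc zero)    a b t = a * t + b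
  S (suc (suc n)) a b t =
    (1# + (2 × 1#) * t) * S (suc n) a b t - (t * t) * S n a b t

  ⟦_⟧ : ℕ → Carrier
  ⟦ m ⟧ = m × 1#

  sumTo : ℕ → (ℕ → Carrier) → Carrier
  sumTo zero    f = f zero
  sumTo (suc n) f = sumTo n f + f (suc n)

  -- Σ_{k=0}^{n} binom(m - k, k) t^k   (m, n natural; here m - k never truncates)
  binSum : ℕ → ℕ → Carrier → Carrier
  binSum m n t = sumTo n (λ k → ⟦ (m ℕ.∸ k) C k ⟧ * t ^ k)

-- S_n(a,b;t) satisfies x_{n+2} = (1 + 2t) x_{n+1} - t² x_n, so it agrees with every
-- sequence satisfying this recurrence and having the same first two terms. Each
-- identity exhibits such a sequence: S_n(1,1) + s S_{n-1}(2,1) because S_n is affine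
-- in b; the binomial sums because they are the two bisections of
-- w_m = Σ_k binom(m-k,k) t^k, which satisfies w_{m+2} = w_{m+1} + t w_m by Pascal's
-- rule; the closed form as a combination of powers of the characteristic roots
-- (1 + 2t ± √(1+4t))/2; and at t = -1/4, where these roots coincide, as a
-- combination of qⁿ and n qⁿ.
module Submission where

open import Defs
open import Level using (Level)
open import Data.Nat.Base as ℕ using (ℕ; zero; suc; _≤_; _∸_)
open import Algebra.Bundles using (CommutativeRing; Semiring)
open import Data.Integer.Base as ℤ using (ℤ; +_; -[1+_]; _⊖_; _◃_)
import Data.Integer.Properties as ℤ
import Data.Nat.Properties as ℕ
import Data.Sign.Base as Sign
import Data.Maybe.Base as Maybe
open import Function.Base using (_∘_)
open import Relation.Binary.Consequences using (dec⇒weaklyDec)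
open import Relation.Binary.PropositionalEquality as ≡ using (_≡_)
open import Algebra.Solver.Ring.AlmostCommutativeRing
  using (_-Raw-AlmostCommutative⟶_; fromCommutativeRing)

module IntegerCoefficients {c ℓ : Level} (R : CommutativeRing c ℓ) where
  open CommutativeRing R
  open import Algebra.Definitions.RawSemiring (Semiring.rawSemiring semiring) using (_×_)
  open import Algebra.Properties.Ring ring using (-‿distribˡ-*; -‿distribʳ-*)
  open import Algebra.Properties.Group +-group using (ε⁻¹≈ε; ⁻¹-involutive)
  open import Algebra.Properties.AbelianGroup +-abelianGroup using (⁻¹-∙-comm)
  open import Algebra.Properties.Semiring.Mult semiring using (×-homo-+; ×1-homo-*)
  open import Relation.Binary.Reasoning.Setoid setoid

  fromℤ : ℤ → Carrier
  fromℤ (+ n)    = n × 1#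
  fromℤ -[1+ n ] = - (suc n × 1#)

  -- The same map with 1 sent to 1# on the nose: the solver's constant 1 must be
  -- definitionally the 1# occurring in goals, while 2, 3, … must be ⟦ 2 ⟧, ⟦ 3 ⟧, ….
  fromℤ′ : ℤ → Carrier
  fromℤ′ (+ 1) = 1#
  fromℤ′ i     = fromℤ i

  fromℤ′≈fromℤ : ∀ i → fromℤ′ i ≈ fromℤ i
  fromℤ′≈fromℤ (+ zero)        = refl
  fromℤ′≈fromℤ (+ suc zero)    = sym (+-identityʳ 1#)
  fromℤ′≈fromℤ (+ suc (suc n)) = refl
  fromℤ′≈fromℤ -[1+ n ]        = refl

  fromℤ-⊖ : ∀ m n → fromℤ (m ⊖ n) ≈ m × 1# - n × 1#
  fromℤ-⊖ m       zero    = sym (trans (+-congˡ ε⁻¹≈ε) (+-identityʳ _))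
  fromℤ-⊖ zero    (suc n) = sym (+-identityˡ _)
  fromℤ-⊖ (suc m) (suc n) = begin
    fromℤ (suc m ⊖ suc n)            ≡⟨ ≡.cong fromℤ (ℤ.[1+m]⊖[1+n]≡m⊖n m n) ⟩
    fromℤ (m ⊖ n)                    ≈⟨ fromℤ-⊖ m n ⟩
    m × 1# - n × 1#                  ≈⟨ +-identityˡ _ ⟨
    0# + (m × 1# - n × 1#)           ≈⟨ +-congʳ (-‿inverseʳ 1#) ⟨
    (1# - 1#) + (m × 1# - n × 1#)    ≈⟨ +-assoc _ _ _ ⟩
    1# + (- 1# + (m × 1# - n × 1#))  ≈⟨ +-congˡ (+-assoc _ _ _) ⟨
    1# + ((- 1# + m × 1#) - n × 1#)  ≈⟨ +-congˡ (+-congʳ (+-comm _ _)) ⟩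
    1# + ((m × 1# - 1#) - n × 1#)    ≈⟨ +-congˡ (+-assoc _ _ _) ⟩
    1# + (m × 1# + (- 1# - n × 1#))  ≈⟨ +-assoc _ _ _ ⟨
    (1# + m × 1#) + (- 1# - n × 1#)  ≈⟨ +-congˡ (⁻¹-∙-comm _ _) ⟩
    suc m × 1# - suc n × 1#          ∎

  fromℤ-+ : ∀ i j → fromℤ (i ℤ.+ j) ≈ fromℤ i + fromℤ j
  fromℤ-+ (+ m)    (+ n)    = ×-homo-+ 1# m n
  fromℤ-+ (+ m)    -[1+ n ] = fromℤ-⊖ m (suc n)
  fromℤ-+ -[1+ m ] (+ n)    = trans (fromℤ-⊖ n (suc m)) (+-comm _ _)
  fromℤ-+ -[1+ m ] -[1+ n ] = begin
    - (suc (suc (m ℕ.+ n)) × 1#)      ≡⟨ ≡.cong (λ k → - (suc k × 1#)) (ℕ.+-suc m n) ⟨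
    - (suc m ℕ.+ suc n) × 1#          ≈⟨ -‿cong (×-homo-+ 1# (suc m) (suc n)) ⟩
    - (suc m × 1# + suc n × 1#)       ≈⟨ ⁻¹-∙-comm _ _ ⟨
    - (suc m × 1#) - suc n × 1#       ∎

  fromℤ-neg : ∀ i → fromℤ (ℤ.- i) ≈ - fromℤ i
  fromℤ-neg (+ zero)  = sym ε⁻¹≈ε
  fromℤ-neg (+ suc n) = refl
  fromℤ-neg -[1+ n ]  = sym (⁻¹-involutive _)

  fromℤ-+◃ : ∀ n → fromℤ (Sign.+ ◃ n) ≈ n × 1#
  fromℤ-+◃ zero    = refl
  fromℤ-+◃ (suc n) = refl

  fromℤ--◃ : ∀ n → fromℤ (Sign.- ◃ n) ≈ - (n × 1#)
  fromℤ--◃ zero    = sym ε⁻¹≈ε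
  fromℤ--◃ (suc n) = refl

  fromℤ-* : ∀ i j → fromℤ (i ℤ.* j) ≈ fromℤ i * fromℤ j
  fromℤ-* (+ m)    (+ n)    = trans (fromℤ-+◃ (m ℕ.* n)) (×1-homo-* m n)
  fromℤ-* (+ m)    -[1+ n ] = begin
    fromℤ (Sign.- ◃ m ℕ.* suc n)      ≈⟨ fromℤ--◃ (m ℕ.* suc n) ⟩
    - ((m ℕ.* suc n) × 1#)            ≈⟨ -‿cong (×1-homo-* m (suc n)) ⟩
    - (m × 1# * suc n × 1#)           ≈⟨ -‿distribʳ-* _ _ ⟩
    m × 1# * - (suc n × 1#)           ∎
  fromℤ-* -[1+ m ] (+ n)    = begin
    fromℤ (Sign.- ◃ suc m ℕ.* n)      ≈⟨ fromℤ--◃ (suc m ℕ.* n) ⟩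
    - ((suc m ℕ.* n) × 1#)            ≈⟨ -‿cong (×1-homo-* (suc m) n) ⟩
    - (suc m × 1# * n × 1#)           ≈⟨ -‿distribˡ-* _ _ ⟩
    - (suc m × 1#) * n × 1#           ∎
  fromℤ-* -[1+ m ] -[1+ n ] = begin
    fromℤ (Sign.+ ◃ suc m ℕ.* suc n)  ≈⟨ fromℤ-+◃ (suc m ℕ.* suc n) ⟩
    (suc m ℕ.* suc n) × 1#            ≈⟨ ×1-homo-* (suc m) (suc n) ⟩
    suc m × 1# * suc n × 1#           ≈⟨ ⁻¹-involutive _ ⟨
    - - (suc m × 1# * suc n × 1#)     ≈⟨ -‿cong (-‿distribʳ-* _ _) ⟩
    - (suc m × 1# * - (suc n × 1#))   ≈⟨ -‿distribˡ-* _ _ ⟩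
    - (suc m × 1#) * - (suc n × 1#)   ∎

  fromℤ-homomorphism : ℤ.+-*-rawRing -Raw-AlmostCommutative⟶ fromCommutativeRing R
  fromℤ-homomorphism = record
    { ⟦_⟧    = fromℤ′
    ; +-homo = λ i j → transport (i ℤ.+ j) (fromℤ-+ i j) (+-cong (fromℤ′≈fromℤ i) (fromℤ′≈fromℤ j))
    ; *-homo = λ i j → transport (i ℤ.* j) (fromℤ-* i j) (*-cong (fromℤ′≈fromℤ i) (fromℤ′≈fromℤ j))
    ; -‿homo = λ i   → transport (ℤ.- i)   (fromℤ-neg i) (-‿cong (fromℤ′≈fromℤ i))
    ; 0-homo = refl
    ; 1-homo = refl
    }
    where
    transport : ∀ i {x y} → fromℤ i ≈ x → y ≈ x → fromℤ′ i ≈ y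
    transport i e y≈x = trans (fromℤ′≈fromℤ i) (trans e (sym y≈x))

  open import Algebra.Solver.Ring ℤ.+-*-rawRing (fromCommutativeRing R) fromℤ-homomorphism
    (λ i j → Maybe.map (reflexive ∘ ≡.cong fromℤ′) (dec⇒weaklyDec ℤ._≟_ i j))
    public using (Polynomial; solve; _:=_; _:+_; _:-_; _:*_; :-_; con)

  κ : ∀ {n} → ℕ → Polynomial n
  κ k = con (+ k)

open import Data.Product using (_×_; _,_)
open import Data.Nat.Combinatorics using (_C_; nCk+nC[k+1]≡[n+1]C[k+1]; k>n⇒nCk≡0)
open import Relation.Nullary using (yes; no)

[1+m∸k]C[1+k]≡[m∸k]C[1+k]+[m∸k]Ck : ∀ m k →
  (suc m ∸ k) C suc k ≡ (m ∸ k) C suc k ℕ.+ (m ∸ k) C k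
[1+m∸k]C[1+k]≡[m∸k]C[1+k]+[m∸k]Ck m k with k ℕ.≤? m
... | yes k≤m rewrite ℕ.+-∸-assoc 1 k≤m = begin
  suc (m ∸ k) C suc k                 ≡⟨ nCk+nC[k+1]≡[n+1]C[k+1] (m ∸ k) k ⟨
  (m ∸ k) C k ℕ.+ (m ∸ k) C suc k     ≡⟨ ℕ.+-comm ((m ∸ k) C k) _ ⟩
  (m ∸ k) C suc k ℕ.+ (m ∸ k) C k     ∎
  where open ≡.≡-Reasoning
... | no k≰m = both-vanish k (ℕ.≰⇒> k≰m)
  where
  both-vanish : ∀ k → m ℕ.< k → (suc m ∸ k) C suc k ≡ (m ∸ k) C suc k ℕ.+ (m ∸ k) C k
  both-vanish (suc k) m<k
    rewrite ℕ.m≤n⇒m∸n≡0 m<k | ℕ.m≤n⇒m∸n≡0 (ℕ.<⇒≤ m<k) = ≡.refl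

[2n∸n]C[1+n]≡0 : ∀ n → (2 ℕ.* n ∸ n) C suc n ≡ 0
[2n∸n]C[1+n]≡0 n = ≡.trans (≡.cong (_C suc n) (ℕ.m+n∸m≡n n (n ℕ.+ 0)))
                           (k>n⇒nCk≡0 (ℕ.s≤s (ℕ.≤-reflexive (ℕ.+-identityʳ n))))

module SecondOrderRecurrences {c ℓ : Level} (R : CommutativeRing c ℓ) where
  open CommutativeRing R
  open SPoly R using (⟦_⟧; _^_)
  open IntegerCoefficients R
  open import Algebra.Properties.Group +-group using (x∙y⁻¹≈ε⇒x≈y; x≈y⇒x∙y⁻¹≈ε)

  Solves : Carrier → Carrier → (ℕ → Carrier) → Set ℓ
  Solves p q x = ∀ n → x (suc (suc n)) ≈ p * x (suc n) - q * x n

  solutions-agree : ∀ {p q x y} → Solves p q x → Solves p q y →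
                    x 0 ≈ y 0 → x 1 ≈ y 1 → ∀ n → x n ≈ y n
  solutions-agree sx sy e₀ e₁ zero          = e₀
  solutions-agree sx sy e₀ e₁ (suc zero)    = e₁
  solutions-agree sx sy e₀ e₁ (suc (suc n)) =
    trans (sx n) (trans (+-cong (*-congˡ (solutions-agree sx sy e₀ e₁ (suc n)))
                                (-‿cong (*-congˡ (solutions-agree sx sy e₀ e₁ n))))
                        (sym (sy n)))

  multiple-of-difference-vanishes : ∀ k {u v} → u ≈ v → k * (u - v) ≈ 0#
  multiple-of-difference-vanishes k u≈v = trans (*-congˡ (x≈y⇒x∙y⁻¹≈ε u≈v)) (zeroʳ k)

  -- Identities that hold modulo hypotheses u ≈ v are obtained from a ring identity
  -- expressing x - y as a combination of the differences u - v.
  ≈-modulo : ∀ k {u v x y} → u ≈ v → x - y ≈ k * (u - v) → x ≈ y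
  ≈-modulo k u≈v eq = x∙y⁻¹≈ε⇒x≈y _ _ (trans eq (multiple-of-difference-vanishes k u≈v))

  ≈-modulo₂ : ∀ k l {u v u′ v′ x y} → u ≈ v → u′ ≈ v′ →
              x - y ≈ k * (u - v) + l * (u′ - v′) → x ≈ y
  ≈-modulo₂ k l u≈v u′≈v′ eq = x∙y⁻¹≈ε⇒x≈y _ _ (trans eq (trans
    (+-cong (multiple-of-difference-vanishes k u≈v)
            (multiple-of-difference-vanishes l u′≈v′))
    (+-identityʳ 0#)))

  combination-solves : ∀ {p q x y} → Solves p q x → Solves p q y →
                       ∀ u v → Solves p q (λ n → u * x n + v * y n)
  combination-solves {p} {q} {x} {y} sx sy u v n =
    trans (+-cong (*-congˡ (sx n)) (*-congˡ (sy n)))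
      (solve 8 (λ p q u v x₀ x₁ y₀ y₁ →
                  u :* (p :* x₁ :- q :* x₀) :+ v :* (p :* y₁ :- q :* y₀)
               := p :* (u :* x₁ :+ v :* y₁) :- q :* (u :* x₀ :+ v :* y₀))
             refl p q u v (x n) (x (suc n)) (y n) (y (suc n)))

  root-powers-solve : ∀ {p q a} → a * a ≈ p * a - q → Solves p q (a ^_)
  root-powers-solve {p} {q} {a} root n = ≈-modulo (a ^ n) root
    (solve 4 (λ p q a aⁿ → a :* (a :* aⁿ) :- (p :* (a :* aⁿ) :- q :* aⁿ)
                        := aⁿ :* (a :* a :- (p :* a :- q)))
           refl p q a (a ^ n))

  double-root-solves : ∀ {p q a} → ⟦ 2 ⟧ * a ≈ p → a * a ≈ p * a - q →
                       Solves p q (λ n → ⟦ n ⟧ * a ^ n)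
  double-root-solves {p} {q} {a} double root n =
    ≈-modulo₂ (a ^ n * a) (⟦ n ⟧ * a ^ n) double root
      (solve 5 (λ p q a n aⁿ →
                  (κ 1 :+ (κ 1 :+ n)) :* (a :* (a :* aⁿ))
                    :- (p :* ((κ 1 :+ n) :* (a :* aⁿ)) :- q :* (n :* aⁿ))
               := aⁿ :* a :* (κ 2 :* a :- p) :+ n :* aⁿ :* (a :* a :- (p :* a :- q)))
             refl p q a ⟦ n ⟧ (a ^ n))

  quadratic-formula : ∀ {p q r h} → r * r ≈ p * p - ⟦ 4 ⟧ * q → ⟦ 2 ⟧ * h ≈ 1# →
                      h * (p + r) * (h * (p + r)) ≈ p * (h * (p + r)) - q
  quadratic-formula {p} {q} {r} {h} discriminant half =
    ≈-modulo₂ (h * h) (h * (p * p + p * r) - (⟦ 2 ⟧ * h + 1#) * q) discriminant half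
      (solve 4 (λ p q r h →
                  h :* (p :+ r) :* (h :* (p :+ r)) :- (p :* (h :* (p :+ r)) :- q)
               := h :* h :* (r :* r :- (p :* p :- κ 4 :* q))
                  :+ (h :* (p :* p :+ p :* r) :- (κ 2 :* h :+ κ 1) :* q) :* (κ 2 :* h :- κ 1))
             refl p q r h)

module SIdentities {c ℓ : Level} (R : CommutativeRing c ℓ) where
  open CommutativeRing R
  open SPoly R
  open IntegerCoefficients R
  open SecondOrderRecurrences R
  open import Algebra.Properties.Semiring.Mult semiring using (×-homo-+)
  open import Algebra.Properties.CommutativeSemiring.Exp commutativeSemiring using (^-distrib-*)
  open import Relation.Binary.Reasoning.Setoid setoid

  S-solves : ∀ a b t → Solves (1# + ⟦ 2 ⟧ * t) (t * t) (λ n → S n a b t)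
  S-solves a b t n = refl

  -- S_{n-1}(2,1;t), the coefficient of b in S_n(a,b;t).
  bCoefficient : Carrier → ℕ → Carrier
  bCoefficient t zero    = 0#
  bCoefficient t (suc n) = S n ⟦ 2 ⟧ 1# t

  bCoefficient-solves : ∀ t → Solves (1# + ⟦ 2 ⟧ * t) (t * t) (bCoefficient t)
  bCoefficient-solves t zero    =
    solve 1 (λ t → κ 2 :* t :+ κ 1 := (κ 1 :+ κ 2 :* t) :* κ 1 :- t :* t :* κ 0) refl t
  bCoefficient-solves t (suc n) = refl

  S-affine-in-b : ∀ a b s t n → S n a (s + b) t ≈ S n a b t + s * bCoefficient t n
  S-affine-in-b a b s t n = begin
    S n a (s + b) t
      ≈⟨ solutions-agree (S-solves a (s + b) t)
           (combination-solves (S-solves a b t) (bCoefficient-solves t) 1# s) initial₀ initial₁ n ⟩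
    1# * S n a b t + s * bCoefficient t n
      ≈⟨ +-congʳ (*-identityˡ _) ⟩
    S n a b t + s * bCoefficient t n
      ∎
    where
    initial₀ : 1# ≈ 1# * 1# + s * 0#
    initial₀ = solve 1 (λ s → κ 1 := κ 1 :* κ 1 :+ s :* κ 0) refl s
    initial₁ : a * t + (s + b) ≈ 1# * (a * t + b) + s * 1#
    initial₁ = solve 4 (λ a b s t → a :* t :+ (s :+ b) := κ 1 :* (a :* t :+ b) :+ s :* κ 1)
                       refl a b s t

  binomial-term-pascal : ∀ t m k →
    ⟦ (suc (suc m) ∸ suc k) C suc k ⟧ * t ^ suc k ≈
      ⟦ (suc m ∸ suc k) C suc k ⟧ * t ^ suc k + t * (⟦ (m ∸ k) C k ⟧ * t ^ k)
  binomial-term-pascal t m k = begin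
    ⟦ (suc m ∸ k) C suc k ⟧ * (t * t ^ k)
      ≡⟨ ≡.cong (λ c → ⟦ c ⟧ * (t * t ^ k)) ([1+m∸k]C[1+k]≡[m∸k]C[1+k]+[m∸k]Ck m k) ⟩
    ⟦ c₁ ℕ.+ c₀ ⟧ * (t * t ^ k)
      ≈⟨ *-congʳ (×-homo-+ 1# c₁ c₀) ⟩
    (⟦ c₁ ⟧ + ⟦ c₀ ⟧) * (t * t ^ k)
      ≈⟨ solve 4 (λ c₁ c₀ t tᵏ → (c₁ :+ c₀) :* (t :* tᵏ) := c₁ :* (t :* tᵏ) :+ t :* (c₀ :* tᵏ))
               refl ⟦ c₁ ⟧ ⟦ c₀ ⟧ t (t ^ k) ⟩
    ⟦ c₁ ⟧ * (t * t ^ k) + t * (⟦ c₀ ⟧ * t ^ k)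
      ∎
    where
    c₀ c₁ : ℕ
    c₀ = (m ∸ k) C k
    c₁ = (m ∸ k) C suc k

  binSum-pascal : ∀ t m N →
    binSum (suc (suc m)) (suc N) t ≈ binSum (suc m) (suc N) t + t * binSum m N t
  binSum-pascal t m zero    = trans (+-congˡ (binomial-term-pascal t m 0))
    (solve 4 (λ a b t c → a :+ (b :+ t :* c) := (a :+ b) :+ t :* c) refl _ _ t _)
  binSum-pascal t m (suc N) =
    trans (+-cong (binSum-pascal t m N) (binomial-term-pascal t m (suc N)))
      (solve 5 (λ a t b c d → (a :+ t :* b) :+ (c :+ t :* d) := (a :+ c) :+ t :* (b :+ d))
             refl _ t _ _ _)

  evenBinSum oddBinSum : Carrier → ℕ → Carrier
  evenBinSum t n = binSum (2 ℕ.* n) n t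
  oddBinSum  t n = binSum (suc (2 ℕ.* n)) n t

  oddBinSum-extend : ∀ t n → binSum (suc (2 ℕ.* n)) (suc n) t ≈ oddBinSum t n
  oddBinSum-extend t n = begin
    oddBinSum t n + ⟦ (2 ℕ.* n ∸ n) C suc n ⟧ * t ^ suc n
      ≡⟨ ≡.cong (λ c → oddBinSum t n + ⟦ c ⟧ * t ^ suc n) ([2n∸n]C[1+n]≡0 n) ⟩
    oddBinSum t n + 0# * t ^ suc n   ≈⟨ +-congˡ (zeroˡ _) ⟩
    oddBinSum t n + 0#               ≈⟨ +-identityʳ _ ⟩
    oddBinSum t n                    ∎

  evenBinSum-step : ∀ t n → evenBinSum t (suc n) ≈ oddBinSum t n + t * evenBinSum t n
  evenBinSum-step t n = begin
    binSum (2 ℕ.* suc n) (suc n) t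
      ≡⟨ ≡.cong (λ m → binSum m (suc n) t) (ℕ.*-suc 2 n) ⟩
    binSum (suc (suc (2 ℕ.* n))) (suc n) t
      ≈⟨ binSum-pascal t (2 ℕ.* n) n ⟩
    binSum (suc (2 ℕ.* n)) (suc n) t + t * evenBinSum t n
      ≈⟨ +-congʳ (oddBinSum-extend t n) ⟩
    oddBinSum t n + t * evenBinSum t n
      ∎

  oddBinSum-step : ∀ t n → oddBinSum t (suc n) ≈ evenBinSum t (suc n) + t * oddBinSum t n
  oddBinSum-step t n = begin
    binSum (suc (2 ℕ.* suc n)) (suc n) t
      ≡⟨ ≡.cong (λ m → binSum (suc m) (suc n) t) (ℕ.*-suc 2 n) ⟩
    binSum (suc (suc (suc (2 ℕ.* n)))) (suc n) t
      ≈⟨ binSum-pascal t (suc (2 ℕ.* n)) n ⟩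
    binSum (suc (suc (2 ℕ.* n))) (suc n) t + t * oddBinSum t n
      ≡⟨ ≡.cong (λ m → binSum m (suc n) t + t * oddBinSum t n) (ℕ.*-suc 2 n) ⟨
    evenBinSum t (suc n) + t * oddBinSum t n
      ∎

  -- The steps above say that evenBinSum and oddBinSum interleave a sequence w with
  -- w_{m+2} = w_{m+1} + t w_m; each bisection of such a sequence satisfies the
  -- recurrence of S.
  bisection-recurrence : ∀ t {x₀ x₁ x₂ y₀ y₁} →
    x₂ ≈ y₁ + t * x₁ → y₁ ≈ x₁ + t * y₀ → x₁ ≈ y₀ + t * x₀ →
    x₂ ≈ (1# + ⟦ 2 ⟧ * t) * x₁ - t * t * x₀
  bisection-recurrence t {x₀} {x₁} {x₂} {y₀} {y₁} e₂ e₁ e₀ =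
    trans (trans e₂ (+-congʳ e₁)) (≈-modulo (- t) e₀
      (solve 4 (λ t x₀ x₁ y₀ →
                  (x₁ :+ t :* y₀) :+ t :* x₁ :- ((κ 1 :+ κ 2 :* t) :* x₁ :- t :* t :* x₀)
               := (:- t) :* (x₁ :- (y₀ :+ t :* x₀)))
             refl t x₀ x₁ y₀))

  evenBinSum-solves : ∀ t → Solves (1# + ⟦ 2 ⟧ * t) (t * t) (evenBinSum t)
  evenBinSum-solves t n = bisection-recurrence t
    (evenBinSum-step t (suc n)) (oddBinSum-step t n) (evenBinSum-step t n)

  oddBinSum-solves : ∀ t → Solves (1# + ⟦ 2 ⟧ * t) (t * t) (oddBinSum t)
  oddBinSum-solves t n = bisection-recurrence t
    (oddBinSum-step t (suc n)) (evenBinSum-step t (suc n)) (oddBinSum-step t n)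

  -- The initial binomial sums compute; κ 1 :+ κ 0 is ⟦ 1 ⟧ = 1# + 0#.
  S-1-1≈evenBinSum : ∀ t n → S n 1# 1# t ≈ evenBinSum t n
  S-1-1≈evenBinSum t = solutions-agree (S-solves 1# 1# t) (evenBinSum-solves t)
    (solve 0 (κ 1 := (κ 1 :+ κ 0) :* κ 1) refl)
    (solve 1 (λ t → κ 1 :* t :+ κ 1 := (κ 1 :+ κ 0) :* κ 1 :+ (κ 1 :+ κ 0) :* (t :* κ 1))
           refl t)

  S-2-1≈oddBinSum : ∀ t n → S n ⟦ 2 ⟧ 1# t ≈ oddBinSum t n
  S-2-1≈oddBinSum t = solutions-agree (S-solves ⟦ 2 ⟧ 1# t) (oddBinSum-solves t)
    (solve 0 (κ 1 := (κ 1 :+ κ 0) :* κ 1) refl)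
    (solve 1 (λ t → κ 2 :* t :+ κ 1 := (κ 1 :+ κ 0) :* κ 1 :+ κ 2 :* (t :* κ 1)) refl t)

  S-binomial-expansion : ∀ s t m →
    S (suc m) 1# (s + 1#) t ≈ binSum (2 ℕ.* suc m) (suc m) t + s * binSum (2 ℕ.* suc m ∸ 1) m t
  S-binomial-expansion s t m = begin
    S (suc m) 1# (s + 1#) t
      ≈⟨ S-affine-in-b 1# 1# s t (suc m) ⟩
    S (suc m) 1# 1# t + s * S m ⟦ 2 ⟧ 1# t
      ≈⟨ +-cong (S-1-1≈evenBinSum t (suc m)) (*-congˡ (S-2-1≈oddBinSum t m)) ⟩
    evenBinSum t (suc m) + s * oddBinSum t m
      ≡⟨ ≡.cong (λ k → evenBinSum t (suc m) + s * binSum (k ∸ 1) m t) (ℕ.*-suc 2 m) ⟨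
    binSum (2 ℕ.* suc m) (suc m) t + s * binSum (2 ℕ.* suc m ∸ 1) m t
      ∎

  -- The characteristic roots are h (p ± r) with p = 1 + 2t, and the solution with the
  -- initial values of S is c₁ (h (p + r))ⁿ - c₂ (h (p - r))ⁿ.
  S-closed-form : ∀ s t r r⁻¹ h → r * r ≈ 1# + ⟦ 4 ⟧ * t → r * r⁻¹ ≈ 1# → ⟦ 2 ⟧ * h ≈ 1# →
    ∀ n → S n 1# (s + 1#) t ≈
            h ^ suc n * r⁻¹ * ((1# + ⟦ 2 ⟧ * s + r) * (1# + ⟦ 2 ⟧ * t + r) ^ n
                               - (1# + ⟦ 2 ⟧ * s - r) * (1# + ⟦ 2 ⟧ * t - r) ^ n)
  S-closed-form s t r r⁻¹ h r² r⁻¹-inverse half n =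
    trans (solutions-agree (S-solves 1# (s + 1#) t) x-solves initial₀ initial₁ n) (x-closed n)
    where
    p u v c₁ c₂ : Carrier
    p  = 1# + ⟦ 2 ⟧ * t
    u  = 1# + ⟦ 2 ⟧ * s + r
    v  = 1# + ⟦ 2 ⟧ * s - r
    c₁ = h * r⁻¹ * u
    c₂ = h * r⁻¹ * v

    discriminant : r * r ≈ p * p - ⟦ 4 ⟧ * (t * t)
    discriminant = trans r² (solve 1 (λ t → κ 1 :+ κ 4 :* t
                                          := (κ 1 :+ κ 2 :* t) :* (κ 1 :+ κ 2 :* t) :- κ 4 :* (t :* t))
                                     refl t)

    discriminant⁻ : - r * - r ≈ p * p - ⟦ 4 ⟧ * (t * t)
    discriminant⁻ = trans (solve 1 (λ r → :- r :* :- r := r :* r) refl r) discriminant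

    x : ℕ → Carrier
    x n = c₁ * (h * (p + r)) ^ n + (- c₂) * (h * (p - r)) ^ n

    x-solves : Solves p (t * t) x
    x-solves = combination-solves (root-powers-solve (quadratic-formula discriminant half))
                                  (root-powers-solve (quadratic-formula discriminant⁻ half))
                                  c₁ (- c₂)

    initial₀ : 1# ≈ x 0
    initial₀ = sym (≈-modulo₂ (r * r⁻¹) 1# half r⁻¹-inverse
      (solve 4 (λ h r⁻¹ s r →
                  h :* r⁻¹ :* (κ 1 :+ κ 2 :* s :+ r) :* κ 1
                  :+ (:- (h :* r⁻¹ :* (κ 1 :+ κ 2 :* s :- r))) :* κ 1 :- κ 1
               := r :* r⁻¹ :* (κ 2 :* h :- κ 1) :+ κ 1 :* (r :* r⁻¹ :- κ 1))
             refl h r⁻¹ s r))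

    initial₁ : 1# * t + (s + 1#) ≈ x 1
    initial₁ = sym (≈-modulo₂ ((⟦ 2 ⟧ * h + 1#) * (r * r⁻¹) * (1# + s + t)) (1# + s + t)
                              half r⁻¹-inverse
      (solve 5 (λ h r⁻¹ s r t →
                  h :* r⁻¹ :* (κ 1 :+ κ 2 :* s :+ r) :* (h :* ((κ 1 :+ κ 2 :* t) :+ r) :* κ 1)
                  :+ (:- (h :* r⁻¹ :* (κ 1 :+ κ 2 :* s :- r))) :* (h :* ((κ 1 :+ κ 2 :* t) :- r) :* κ 1)
                  :- (κ 1 :* t :+ (s :+ κ 1))
               := (κ 2 :* h :+ κ 1) :* (r :* r⁻¹) :* (κ 1 :+ s :+ t) :* (κ 2 :* h :- κ 1)
                  :+ (κ 1 :+ s :+ t) :* (r :* r⁻¹ :- κ 1))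
             refl h r⁻¹ s r t))

    x-closed : ∀ n → x n ≈ h ^ suc n * r⁻¹ * (u * (p + r) ^ n - v * (p - r) ^ n)
    x-closed n =
      trans (+-cong (*-congˡ (^-distrib-* h (p + r) n)) (*-congˡ (^-distrib-* h (p - r) n)))
        (solve 7 (λ h hⁿ r⁻¹ u v a b →
                    h :* r⁻¹ :* u :* (hⁿ :* a) :+ (:- (h :* r⁻¹ :* v)) :* (hⁿ :* b)
                 := h :* hⁿ :* r⁻¹ :* (u :* a :- v :* b))
               refl h (h ^ n) r⁻¹ u v ((p + r) ^ n) ((p - r) ^ n))

  -- At t = -1/4 both characteristic roots equal q = 1/4.
  S-at-minus-quarter : ∀ s q → ⟦ 4 ⟧ * q ≈ 1# → ∀ n →
    S n 1# (s + 1#) (- q) ≈ (⟦ 4 ⟧ * ⟦ n ⟧ * s + ⟦ 2 ⟧ * ⟦ n ⟧ + 1#) * q ^ n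
  S-at-minus-quarter s q quarter n =
    trans (solutions-agree (S-solves 1# (s + 1#) (- q)) x-solves initial₀ initial₁ n) x-closed
    where
    p : Carrier
    p = 1# + ⟦ 2 ⟧ * - q

    double : ⟦ 2 ⟧ * q ≈ p
    double = ≈-modulo 1# quarter
      (solve 1 (λ q → κ 2 :* q :- (κ 1 :+ κ 2 :* :- q) := κ 1 :* (κ 4 :* q :- κ 1)) refl q)

    root : q * q ≈ p * q - - q * - q
    root = ≈-modulo q quarter
      (solve 1 (λ q → q :* q :- ((κ 1 :+ κ 2 :* :- q) :* q :- :- q :* :- q)
                   := q :* (κ 4 :* q :- κ 1))
             refl q)

    x : ℕ → Carrier
    x n = (⟦ 4 ⟧ * s + ⟦ 2 ⟧) * (⟦ n ⟧ * q ^ n) + 1# * q ^ n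

    x-solves : Solves p (- q * - q) x
    x-solves = combination-solves (double-root-solves double root) (root-powers-solve root)
                                  (⟦ 4 ⟧ * s + ⟦ 2 ⟧) 1#

    initial₀ : 1# ≈ x 0
    initial₀ = solve 1 (λ s → κ 1 := (κ 4 :* s :+ κ 2) :* (κ 0 :* κ 1) :+ κ 1 :* κ 1) refl s

    initial₁ : 1# * - q + (s + 1#) ≈ x 1
    initial₁ = sym (≈-modulo (s + 1#) quarter
      (solve 2 (λ s q →
                  (κ 4 :* s :+ κ 2) :* ((κ 1 :+ κ 0) :* (q :* κ 1)) :+ κ 1 :* (q :* κ 1)
                  :- (κ 1 :* :- q :+ (s :+ κ 1))
               := (s :+ κ 1) :* (κ 4 :* q :- κ 1))
             refl s q))

    x-closed : x n ≈ (⟦ 4 ⟧ * ⟦ n ⟧ * s + ⟦ 2 ⟧ * ⟦ n ⟧ + 1#) * q ^ n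
    x-closed = solve 3 (λ s n qⁿ → (κ 4 :* s :+ κ 2) :* (n :* qⁿ) :+ κ 1 :* qⁿ
                                := (κ 4 :* n :* s :+ κ 2 :* n :+ κ 1) :* qⁿ)
                       refl s ⟦ n ⟧ (q ^ n)

proposition2p6 : {c ℓ : Level} (R : CommutativeRing c ℓ) →
    let open CommutativeRing R
        open SPoly R
    in
    ((s t : Carrier) (n : ℕ) → 1 ≤ n →
      (S n 1# (s + 1#) t ≈ S n 1# 1# t + s * S (n ∸ 1) (⟦ 2 ⟧) 1# t)
      × (S n 1# (s + 1#) t ≈
           binSum (2 ℕ.* n) n t + s * binSum (2 ℕ.* n ∸ 1) (n ∸ 1) t))
    ×
    ((s t r rinv h : Carrier) (n : ℕ) → 1 ≤ n →
      r * r ≈ 1# + ⟦ 4 ⟧ * t → r * rinv ≈ 1# → ⟦ 2 ⟧ * h ≈ 1# →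
      S n 1# (s + 1#) t ≈
        (h ^ (suc n)) * rinv *
          ((1# + ⟦ 2 ⟧ * s + r) * (1# + ⟦ 2 ⟧ * t + r) ^ n
           - (1# + ⟦ 2 ⟧ * s - r) * (1# + ⟦ 2 ⟧ * t - r) ^ n))
    ×
    ((s q : Carrier) (n : ℕ) → 1 ≤ n → ⟦ 4 ⟧ * q ≈ 1# →
      S n 1# (s + 1#) (- q) ≈
        (⟦ 4 ⟧ * ⟦ n ⟧ * s + ⟦ 2 ⟧ * ⟦ n ⟧ + 1#) * q ^ n)
proposition2p6 R =
    (λ { s t (suc m) _ → S-affine-in-b 1# 1# s t (suc m) , S-binomial-expansion s t m })
  , (λ s t r r⁻¹ h n _ r² r⁻¹-inverse half → S-closed-form s t r r⁻¹ h r² r⁻¹-inverse half n)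
  , (λ s q n _ quarter → S-at-minus-quarter s q quarter n)
  where open CommutativeRing R using (1#)
        open SIdentities R
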